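{- Let $n\ge 3$ and let $f$ be an $(n-2)$-eigenfunction of the Star graph $S_n$. Then $f(\pi)=\sum_{i=1}^n m_{i,\pi^{ -1}(i)}(f)$ for every $\pi\in Sym_n$.
   Context: For $n\ge 3$, the Star graph $S_n$ is the Cayley graph on $Sym_n$ with generating set $\{(1\,i): 2\le i\le n\}$. A $\lambda$-eigenfunction is a nonzero $f:Sym_n\to\mathbb{R}$ with $\lambda f(x)=\sum_{y\in N(x)}f(y)$ for all $x$. For $u\in\{1,\ldots,n\}$ and $v\ne w$ in $\{2,\ldots,n\}$, $f_u^{v,w}(\pi)$ equals $1$ if $\pi(v)=u$, $-1$ if $\pi(w)=u$, and $0$ otherwise. It is known that the functions $f_i^{2,j}$, $i\in\{2,\ldots,n\}$, $j\in\{3,\ldots,n\}$, form a basis of the $(n-2)$-eigenspace of $S_n$; so $f=\sum_{i\in\{2,\ldots,n\},\,j\in\{3,\ldots,n\}}\mu_i^j(f) f_i^{2,j}$ for unique reals $\mu_i^j(f)$. Define the $n\times n$ matrix $M(f)=(m_{i,j}(f))$ by $m_{i,j}(f)=-\mu_i^j(f)$ if $i>1,j>2$; $m_{i,2}(f)=\sum_{s=3}^n\mu_i^s(f)$ if $i>1$; and $m_{i,j}(f)=0$ if $i=1$ or $j=1$. -}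

module Defs where

open import Level using (Level)
open import Data.Nat using (ℕ; zero; suc)
open import Data.Fin using (Fin; zero; suc; _≟_)
open import Data.Fin.Permutation using (Permutation′; _⟨$⟩ʳ_; _⟨$⟩ˡ_; _∘ₚ_; transpose)
open import Data.Product using (∃; _×_)
open import Relation.Nullary using (¬_; yes; no)
open import Algebra.Bundles using (CommutativeRing)

-- Vertex labels {1,…,n} are represented by Fin n, with paper label
-- ℓ corresponding to the element of Fin n with toℕ = ℓ - 1.
-- We always write n = k + 3 (i.e. n = suc (suc (suc k))) to encode n ≥ 3.
module StarGraph {c ℓ : Level} (R : CommutativeRing c ℓ) where
  open CommutativeRing R public using (Carrier; _≈_; _+_; _*_; -_; 0#; 1#)

  Σ : ∀ {n} → (Fin n → Carrier) → Carrier
  Σ {zero}  g = 0#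
  Σ {suc n} g = g zero + Σ (λ i → g (suc i))

  ℕ⟶R : ℕ → Carrier
  ℕ⟶R zero    = 0#
  ℕ⟶R (suc m) = 1# + ℕ⟶R m

  -- Sym_n, with π ⟨$⟩ʳ v = π(v) and π ⟨$⟩ˡ u = π⁻¹(u)
  Sym : ℕ → Set
  Sym n = Permutation′ n

  -- sum of g over the neighbours of x in the Star graph S_n, n = k+3:
  -- the neighbours are x ∘ (1 i), 2 ≤ i ≤ n, i.e. the maps v ↦ x((1 i) v).
  -- (transpose zero i ∘ₚ x applies the transposition first, then x.)
  neighbourSum : (k : ℕ) → (Sym (suc (suc (suc k))) → Carrier)
               → Sym (suc (suc (suc k))) → Carrier
  neighbourSum k g x = Σ (λ (i : Fin (suc (suc k))) → g (transpose zero (suc i) ∘ₚ x))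

  IsEigenfunction : (k : ℕ) → Carrier → (Sym (suc (suc (suc k))) → Carrier) → Set ℓ
  IsEigenfunction k λ′ g =
    (∃ λ x → ¬ (g x ≈ 0#)) × (∀ x → λ′ * g x ≈ neighbourSum k g x)

  f[_]^[_,_] : ∀ {n} → Fin n → Fin n → Fin n → Sym n → Carrier
  f[ u ]^[ v , w ] π with π ⟨$⟩ʳ v ≟ u | π ⟨$⟩ʳ w ≟ u
  ... | yes _ | _     = 1#
  ... | no _  | yes _ = - 1#
  ... | no _  | no _  = 0#

  -- Coefficient families μ_i^j for i ∈ {2,…,n}, j ∈ {3,…,n}:
  -- μ i′ j′ stands for μ_i^j with i = suc i′, j = suc (suc j′) (as Fin n).
  Coeffs : ℕ → Set c
  Coeffs k = Fin (suc (suc k)) → Fin (suc k) → Carrier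

  expansion : (k : ℕ) → Coeffs k → Sym (suc (suc (suc k))) → Carrier
  expansion k μ π =
    Σ (λ (i : Fin (suc (suc k))) → Σ (λ (j : Fin (suc k)) →
      μ i j * f[ suc i ]^[ suc zero , suc (suc j) ] π))

  M : (k : ℕ) → Coeffs k → Fin (suc (suc (suc k))) → Fin (suc (suc (suc k))) → Carrier
  M k μ zero    _             = 0#
  M k μ (suc i) zero          = 0#
  M k μ (suc i) (suc zero)    = Σ (λ (s : Fin (suc k)) → μ i s)
  M k μ (suc i) (suc (suc j)) = - (μ i j)

-- Each f_i^{2,j}(π) is the difference [π(2) = i] − [π(j) = i] of indicators, so
-- summing it against μ_i^j over i picks out μ_{π(2)}^j − μ_{π(j)}^j (with μ_1^j := 0).
-- Summing over j then gives m_{π(2),2} + Σ_{j≥3} m_{π(j),j}, and since the first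
-- column of M(f) vanishes this is Σ_v m_{π(v),v}, which is Σ_i m_{i,π⁻¹(i)} after
-- reindexing by π.
module Submission where

open import Defs
open import Level using (Level)
open import Data.Nat using (ℕ; suc; zero)
open import Data.Fin using (Fin; zero; suc; _≟_)
open import Data.Fin.Patterns using (0F; 1F)
open import Data.Fin.Permutation using (Permutation′; _⟨$⟩ˡ_; _⟨$⟩ʳ_; inverseˡ)
open import Data.Vec.Functional using (_∷_)
open import Function.Bundles using (Injection)
open import Function.Properties.Inverse using (↔⇒↣)
open import Algebra.Bundles using (CommutativeRing)
open import Relation.Nullary using (yes; no; ¬_; contradiction)
open import Relation.Binary.PropositionalEquality as ≡ using (_≡_)
import Algebra.Properties.CommutativeMonoid.Sum as CommutativeMonoidSum
import Algebra.Properties.CommutativeSemigroup as CommutativeSemigroupProperties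
import Algebra.Properties.Ring as RingProperties
import Relation.Binary.Reasoning.Setoid as SetoidReasoning

module _ {c ℓ : Level} (R : CommutativeRing c ℓ) where
  open StarGraph R
  open CommutativeRing R using (_-_; setoid; refl; sym; trans; reflexive;
    +-cong; +-congˡ; +-congʳ; *-congˡ; -‿cong;
    +-identityˡ; +-identityʳ; *-identityʳ; zeroˡ; zeroʳ;
    +-commutativeMonoid; +-commutativeSemigroup; ring)
  open RingProperties ring using (-0#≈0#; -‿+-comm; x[y-z]≈xy-xz)
  open CommutativeSemigroupProperties +-commutativeSemigroup using (interchange)
  open CommutativeMonoidSum +-commutativeMonoid using (sum; sum-permute)
  open SetoidReasoning setoid

  Σ-cong : ∀ {n} {g h : Fin n → Carrier} → (∀ i → g i ≈ h i) → Σ g ≈ Σ h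
  Σ-cong {zero}  g≈h = refl
  Σ-cong {suc n} g≈h = +-cong (g≈h zero) (Σ-cong (λ i → g≈h (suc i)))

  Σ-zero : ∀ {n} → Σ {n} (λ _ → 0#) ≈ 0#
  Σ-zero {zero}  = refl
  Σ-zero {suc n} = trans (+-identityˡ _) (Σ-zero {n})

  Σ-distrib-+ : ∀ {n} (g h : Fin n → Carrier) → Σ (λ i → g i + h i) ≈ Σ g + Σ h
  Σ-distrib-+ {zero}  g h = sym (+-identityˡ 0#)
  Σ-distrib-+ {suc n} g h =
    trans (+-congˡ (Σ-distrib-+ (λ i → g (suc i)) (λ i → h (suc i))))
          (interchange (g zero) (h zero) _ _)

  Σ-neg : ∀ {n} (g : Fin n → Carrier) → Σ (λ i → - g i) ≈ - Σ g
  Σ-neg {zero}  g = sym -0#≈0#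
  Σ-neg {suc n} g = trans (+-congˡ (Σ-neg (λ i → g (suc i)))) (-‿+-comm _ _)

  Σ-distrib-− : ∀ {n} (g h : Fin n → Carrier) → Σ (λ i → g i - h i) ≈ Σ g - Σ h
  Σ-distrib-− g h = trans (Σ-distrib-+ g (λ i → - h i)) (+-congˡ (Σ-neg h))

  Σ-swap : ∀ {m n} (g : Fin m → Fin n → Carrier) →
           Σ (λ i → Σ (λ j → g i j)) ≈ Σ (λ j → Σ (λ i → g i j))
  Σ-swap {zero}  {n} g = sym (Σ-zero {n})
  Σ-swap {suc m}     g = trans (+-congˡ (Σ-swap (λ i → g (suc i))))
                               (sym (Σ-distrib-+ (g zero) (λ j → Σ (λ i → g (suc i) j))))

  Σ-dropFirst : ∀ {n} (g : Fin (suc n) → Carrier) → g zero ≈ 0# →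
                Σ g ≈ Σ (λ i → g (suc i))
  Σ-dropFirst g g0≈0 = trans (+-congʳ g0≈0) (+-identityˡ _)

  Σ≈sum : ∀ {n} (g : Fin n → Carrier) → Σ g ≈ sum g
  Σ≈sum {zero}  g = refl
  Σ≈sum {suc n} g = +-congˡ (Σ≈sum (λ i → g (suc i)))

  Σ-permute : ∀ {n} (g : Fin n → Carrier) (π : Permutation′ n) →
              Σ g ≈ Σ (λ i → g (π ⟨$⟩ʳ i))
  Σ-permute g π = begin
    Σ g                      ≈⟨ Σ≈sum g ⟩
    sum g                    ≈⟨ sum-permute g π ⟩
    sum (λ i → g (π ⟨$⟩ʳ i)) ≈⟨ Σ≈sum (λ i → g (π ⟨$⟩ʳ i)) ⟨
    Σ (λ i → g (π ⟨$⟩ʳ i))   ∎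

  δ : ∀ {n} → Fin n → Fin n → Carrier
  δ a u with a ≟ u
  ... | yes _ = 1#
  ... | no _  = 0#

  Σ-*δ : ∀ {n} (g : Fin n → Carrier) (a : Fin n) → Σ (λ u → g u * δ a u) ≈ g a
  Σ-*δ {suc n} g zero = begin
    g zero * 1# + Σ (λ u → g (suc u) * 0#)
      ≈⟨ +-cong (*-identityʳ _) (Σ-cong {n} (λ u → zeroʳ (g (suc u)))) ⟩
    g zero + Σ {n} (λ _ → 0#)
      ≈⟨ +-congˡ (Σ-zero {n}) ⟩
    g zero + 0#
      ≈⟨ +-identityʳ _ ⟩
    g zero ∎
  Σ-*δ {suc n} g (suc a) = begin
    g zero * 0# + Σ (λ u → g (suc u) * δ (suc a) (suc u))
      ≈⟨ Σ-dropFirst (λ u → g u * δ (suc a) u) (zeroʳ _) ⟩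
    Σ (λ u → g (suc u) * δ (suc a) (suc u))
      ≈⟨ Σ-cong {n} (λ u → *-congˡ (δ-suc u)) ⟩
    Σ (λ u → g (suc u) * δ a u)
      ≈⟨ Σ-*δ (λ u → g (suc u)) a ⟩
    g (suc a) ∎
    where
    δ-suc : ∀ u → δ (suc a) (suc u) ≈ δ a u
    δ-suc u with a ≟ u
    ... | yes _ = refl
    ... | no _  = refl

  f≈δ-δ : ∀ {n} (π : Permutation′ n) (u : Fin n) {v w : Fin n} → ¬ v ≡ w →
          f[ u ]^[ v , w ] π ≈ δ (π ⟨$⟩ʳ v) u - δ (π ⟨$⟩ʳ w) u
  f≈δ-δ π u {v} {w} v≢w with π ⟨$⟩ʳ v ≟ u | π ⟨$⟩ʳ w ≟ u
  ... | yes πv≡u | yes πw≡u =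
    contradiction (Injection.injective (↔⇒↣ π) (≡.trans πv≡u (≡.sym πw≡u))) v≢w
  ... | yes _ | no _  = sym (trans (+-congˡ -0#≈0#) (+-identityʳ 1#))
  ... | no _  | yes _ = sym (+-identityˡ _)
  ... | no _  | no _  = sym (trans (+-identityˡ _) -0#≈0#)

  Σ-*f : ∀ {n} (g : Fin n → Carrier) (π : Permutation′ n) {v w : Fin n} → ¬ v ≡ w →
         Σ (λ u → g u * f[ u ]^[ v , w ] π) ≈ g (π ⟨$⟩ʳ v) - g (π ⟨$⟩ʳ w)
  Σ-*f g π {v} {w} v≢w = begin
    Σ (λ u → g u * f[ u ]^[ v , w ] π)
      ≈⟨ Σ-cong (λ u → *-congˡ (f≈δ-δ π u v≢w)) ⟩
    Σ (λ u → g u * (δ a u - δ b u))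
      ≈⟨ Σ-cong (λ u → x[y-z]≈xy-xz (g u) (δ a u) (δ b u)) ⟩
    Σ (λ u → g u * δ a u - g u * δ b u)
      ≈⟨ Σ-distrib-− (λ u → g u * δ a u) (λ u → g u * δ b u) ⟩
    Σ (λ u → g u * δ a u) - Σ (λ u → g u * δ b u)
      ≈⟨ +-cong (Σ-*δ g a) (-‿cong (Σ-*δ g b)) ⟩
    g a - g b ∎
    where
    a = π ⟨$⟩ʳ v
    b = π ⟨$⟩ʳ w

  module _ (k : ℕ) (μ : Coeffs k) where

    μ-column : Fin (suc k) → Fin (suc (suc (suc k))) → Carrier
    μ-column j = 0# ∷ λ i → μ i j

    M-firstColumn : ∀ i → M k μ i zero ≈ 0#
    M-firstColumn zero    = refl
    M-firstColumn (suc i) = refl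

    M-secondColumn : ∀ i → M k μ i (suc zero) ≈ Σ (λ j → μ-column j i)
    M-secondColumn zero    = sym (Σ-zero {suc k})
    M-secondColumn (suc i) = refl

    M-laterColumn : ∀ i j → M k μ i (suc (suc j)) ≈ - μ-column j i
    M-laterColumn zero    j = sym -0#≈0#
    M-laterColumn (suc i) j = refl

    expansion-column : ∀ π j →
      Σ (λ i → μ i j * f[ suc i ]^[ suc zero , suc (suc j) ] π)
        ≈ μ-column j (π ⟨$⟩ʳ suc zero) - μ-column j (π ⟨$⟩ʳ suc (suc j))
    expansion-column π j = begin
      Σ (λ i → μ i j * f[ suc i ]^[ suc zero , suc (suc j) ] π)
        ≈⟨ Σ-dropFirst (λ u → μ-column j u * f[ u ]^[ suc zero , suc (suc j) ] π) (zeroˡ _) ⟨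
      Σ (λ u → μ-column j u * f[ u ]^[ suc zero , suc (suc j) ] π)
        ≈⟨ Σ-*f (μ-column j) π (λ ()) ⟩
      μ-column j (π ⟨$⟩ʳ suc zero) - μ-column j (π ⟨$⟩ʳ suc (suc j)) ∎

    Σ-M-reindex : ∀ π → Σ (λ i → M k μ i (π ⟨$⟩ˡ i)) ≈ Σ (λ v → M k μ (π ⟨$⟩ʳ v) v)
    Σ-M-reindex π =
      trans (Σ-permute (λ i → M k μ i (π ⟨$⟩ˡ i)) π)
            (Σ-cong (λ v → reflexive (≡.cong (M k μ (π ⟨$⟩ʳ v)) (inverseˡ π {v}))))

    expansion≈Σ-M : ∀ π → expansion k μ π ≈ Σ (λ i → M k μ i (π ⟨$⟩ˡ i))
    expansion≈Σ-M π = begin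
      expansion k μ π
        ≈⟨ Σ-swap (λ i j → μ i j * f[ suc i ]^[ suc zero , suc (suc j) ] π) ⟩
      Σ (λ j → Σ (λ i → μ i j * f[ suc i ]^[ suc zero , suc (suc j) ] π))
        ≈⟨ Σ-cong (expansion-column π) ⟩
      Σ (λ j → μ-column j (σ 1F) - μ-column j (σ (2+ j)))
        ≈⟨ Σ-distrib-− (λ j → μ-column j (σ 1F)) (λ j → μ-column j (σ (2+ j))) ⟩
      Σ (λ j → μ-column j (σ 1F)) - Σ (λ j → μ-column j (σ (2+ j)))
        ≈⟨ +-cong (M-secondColumn (σ 1F)) (Σ-neg (λ j → μ-column j (σ (2+ j)))) ⟨
      M k μ (σ 1F) 1F + Σ (λ j → - μ-column j (σ (2+ j)))
        ≈⟨ +-congˡ (Σ-cong (λ j → M-laterColumn (σ (2+ j)) j)) ⟨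
      M k μ (σ 1F) 1F + Σ (λ j → M k μ (σ (2+ j)) (2+ j))
        ≈⟨ Σ-dropFirst (λ v → M k μ (σ v) v) (M-firstColumn (σ 0F)) ⟨
      Σ (λ v → M k μ (σ v) v)
        ≈⟨ Σ-M-reindex π ⟨
      Σ (λ i → M k μ i (π ⟨$⟩ˡ i)) ∎
      where
      σ : Fin (suc (suc (suc k))) → Fin (suc (suc (suc k)))
      σ v = π ⟨$⟩ʳ v
      2+ : Fin (suc k) → Fin (suc (suc (suc k)))
      2+ j = suc (suc j)

-- The eigenfunction hypothesis only guarantees that the coefficients μ exist;
-- the identity holds for every function given by such an expansion.
lemma3 : {c ℓ : Level} (R : CommutativeRing c ℓ) → let open StarGraph R in
    (k : ℕ) (f : Sym (suc (suc (suc k))) → Carrier) →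
    IsEigenfunction k (ℕ⟶R (suc k)) f →
    (μ : Coeffs k) → (∀ π → f π ≈ expansion k μ π) →
    ∀ π → f π ≈ Σ (λ i → M k μ i (π ⟨$⟩ˡ i))
lemma3 R k f _ μ f≈expansion π =
  CommutativeRing.trans R (f≈expansion π) (expansion≈Σ-M R k μ π)
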